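{- Let $\ell$ be a well-typed let-term with output $\vec v$, let $\mathcal F=\mathrm{Var}(\mathrm{Facts}(\ell))$, and let $a\in|FV(\ell)|$, $b\in|FV(\vec v)|$. If $a|_{FV(\ell)\cap FV(\vec v)}=b|_{FV(\ell)\cap FV(\vec v)}$, then, setting $a'=a|_{FV(\ell)\setminus FV(\vec v)}$, $b'=b|_{FV(\vec v)\setminus FV(\ell)}$ and $c=a|_{FV(\ell)\cap FV(\vec v)}=b|_{FV(\ell)\cap FV(\vec v)}$, $$[\![\ell]\!]_{a,b}=\Big(\sum_{\mathcal F\setminus(FV(\ell)\cup FV(\vec v))}\bigodot\mathrm{Facts}(\ell)\Big)(a'\uplus c\uplus b').$$ Otherwise $[\![\ell]\!]_{a,b}=0$. In particular, if $\ell$ is closed, then $[\![\ell]\!]_{\star,b}=\big(\sum_{\mathcal F\setminus FV(\vec v)}\bigodot\mathrm{Facts}(\ell)\big)(b)$.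
   Context: Types: positive types $P,Q::=\mathsf{Bool}\mid P\otimes Q$; arrow types $N::=P\multimap T$; let-term types $T,U::=P\mid N\mid P\otimes T$. Each variable carries a fixed type $\mathsf{ty}(v)$, positive or arrow; $x,y,z$ denote positive variables, $f,g,h$ arrow variables. Webs: $|\mathsf{Bool}|=\{\mathsf t,\mathsf f\}$, $|P\otimes T|=|P\multimap T|=|P|\times|T|$. Constants $M$ are stochastic matrices in $\mathbb R_{\ge0}^{|P|\times|Q|}$ of type $P\multimap Q$ (or $0$-ary probability vectors of type $Q$). Syntax: patterns $\vec v::=v\mid(\vec v,\vec v')$ (components with disjoint variables); expressions $e::=v\mid M(\vec x)\mid f\,\vec x\mid (e,e')\mid \lambda\vec x.e\mid \mathtt{let}\ \vec v=e\ \mathtt{in}\ e'$ ($\vec x$ a pattern of positive variables); let-terms $\ell::=\vec v\mid \mathtt{let}\ \vec v=e\ \mathtt{in}\ \ell$. Binders: $\lambda$ and $\mathtt{let}$ bind the pattern's variables in the body; $FV$, $FV^a$ (arrow free variables) as usual. Typing: $v:\mathsf{ty}(v)$; $f:P\multimap T,\vec x:P\Rightarrow f\vec x:T$; $M:P\multimap Q,\vec x:P\Rightarrow M(\vec x):Q$; $\vec x:P,e:T\Rightarrow\lambda\vec x.e:P\multimap T$; $e:P,e':T$, $FV^a(e)\cap FV^a(e')=\emptyset\Rightarrow(e,e'):P\otimes T$; $\vec v:T,e:T,e':U$, $FV^a(e)\cap FV^a(e')=\emptyset$, each arrow variable of $\vec v$ in $FV^a(e')$ $\Rightarrow\mathtt{let}\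 \vec v=e\ \mathtt{in}\ e':U$. The let-term $\mathtt{let}\ \vec v_1=e_1\ \mathtt{in}\cdots\mathtt{let}\ \vec v_n=e_n\ \mathtt{in}\ \vec v_{n+1}$ has definitions $\vec v_i=e_i$ and output $\vec v_{n+1}$; bound variables are pairwise distinct and distinct from free variables. Semantics: $|V|=\prod_{v\in V}|\mathsf{ty}(v)|$ for finite sets of variables (functions $a$, $a_v\in|\mathsf{ty}(v)|$; $\star$ the empty function; $a|_{V'}$ restriction; $a\uplus b$ union for disjoint domains). Elements of $|FV(\vec v)|$ are identified with elements of $|\mathsf{ty}(\vec v)|$ via the tuple structure of $\vec v$. $[\![e]\!]\in\mathbb R_{\ge0}^{|FV(e)|\times|\mathsf{ty}(e)|}$: $[\![v]\!]_{a,b}=\delta_{a_v,b}$; $[\![(e',e'')]\!]_{a,(b',b'')}=[\![e']\!]_{a|_{FV(e')},b'}[\![e'']\!]_{a|_{FV(e'')},b''}$; $[\![\mathtt{let}\ \vec v=e'\ \mathtt{in}\ e'']\!]_{a,b}=\sum_{c\in|FV(\vec v)|}[\![e']\!]_{a|_{FV(e')},c}[\![e'']\!]_{(a\uplus c)|_{FV(e'')},b}$; $[\![\lambda\vec v.e']\!]_{a,(b',b'')}=[\![e']\!]_{(a\uplus b')|_{FV(e')},b''}$; $[\![M(\vec x)]\!]_{a,b}=M_{a,b}$; $[\![f\vec x]\!]_{a,b}=\delta_{a',a'''}\delta_{a'',b}$ where $a_f=(a',a'')$, $a|_{\vec x}=a'''$. Factors: a factor $\varphi$ is a finite set of variables $\mathrm{Var}(\varphi)$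 with a function $\varphi:|\mathrm{Var}(\varphi)|\to\mathbb R_{\ge0}$. $\mathrm{Var}(\sum_S\varphi)=\mathrm{Var}(\varphi)\setminus S$, $(\sum_S\varphi)(a)=\sum_{b\in|S\cap\mathrm{Var}(\varphi)|}\varphi(a\uplus b)$; $\mathrm{Var}(\varphi\odot\psi)=\mathrm{Var}(\varphi)\cup\mathrm{Var}(\psi)$, $(\varphi\odot\psi)(c)=\varphi(c|_{\mathrm{Var}(\varphi)})\psi(c|_{\mathrm{Var}(\psi)})$. For a finite set $\Gamma$ of factors: $\bigodot\Gamma$ is the product of all of them; $\mathrm{Var}(\Gamma)=\bigcup_{\varphi\in\Gamma}\mathrm{Var}(\varphi)$; $\Gamma_V=\{\varphi\in\Gamma:\mathrm{Var}(\varphi)\cap V\neq\emptyset\}$, $\Gamma_{\neg V}=\Gamma\setminus\Gamma_V$ ($\Gamma_v$ for $V=\{v\}$). $\mathrm{Fact}(\vec v=e)$ (for $FV(\vec v)\cap FV(e)=\emptyset$) has variables $FV(e)\uplus FV(\vec v)$ and function $a\uplus c\mapsto[\![e]\!]_{a,c}$. $\mathrm{Facts}(\ell)$ is defined by induction: $\mathrm{Facts}(\vec w)=\{(FV(\vec w),a\mapsto1)\}$; if $\ell$ has output $\vec w$, $\mathrm{Facts}(\mathtt{let}\ \vec v=e\ \mathtt{in}\ \ell)=\{\sum_{\{f\}}(\mathrm{Fact}(\vec v=e)\odot\bigodot\mathrm{Facts}(\ell)_f)\}\uplus\mathrm{Facts}(\ell)_{\neg f}$ if $\vec v$ contains an arrow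 variable $f\notin FV(\vec w)$, and $\{\mathrm{Fact}(\vec v=e)\}\uplus\mathrm{Facts}(\ell)$ otherwise. Bound variable names are used as factor variables (no renaming). -}

module Defs where

open import Level using (Level; _⊔_)
open import Data.Bool as B using (Bool; true; false; _≟_; _∧_; _∨_; not; if_then_else_; T)
open import Data.Nat as N using (ℕ)
open import Data.Product using (_×_; _,_; proj₁; proj₂)
open import Data.List using (List; []; _∷_; _++_; filter; foldr; map; concatMap; deduplicate)
open import Data.Bool.ListAction using (any)
open import Data.Maybe using (Maybe; just; nothing)
open import Data.Empty using (⊥)
open import Relation.Nullary using (Dec; yes; no; ¬_; does)
open import Relation.Binary.PropositionalEquality using (_≡_; refl; cong; cong₂)
open import Relation.Binary.Definitions using (DecidableEquality)
open import Data.List.Membership.Propositional using (_∈_; _∉_)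
open import Data.List.Relation.Unary.Unique.Propositional using (Unique)
open import Algebra.Bundles using (CommutativeSemiring)

-- Types.  A single raw grammar; the paper's classes (positive types P,
-- arrow types N, let-term types T) are carved out by predicates.

infixr 6 _⊗_
infixr 5 _⊸_

data Ty : Set where
  bool : Ty
  _⊗_  : Ty → Ty → Ty
  _⊸_  : Ty → Ty → Ty

mutual
  isPos : Ty → Bool
  isPos bool    = true
  isPos (A ⊗ B) = isPos A ∧ isPos B
  isPos (A ⊸ B) = false

  isArr : Ty → Bool
  isArr bool    = false
  isArr (A ⊗ B) = false
  isArr (A ⊸ B) = isPos A ∧ isLet B

  isLet : Ty → Bool
  isLet bool    = true
  isLet (A ⊗ B) = isPos A ∧ isLet B
  isLet (A ⊸ B) = isArr (A ⊸ B)

IsPos IsArr IsLet : Ty → Set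
IsPos A = T (isPos A)
IsArr A = T (isArr A)
IsLet A = T (isLet A)

_≟T_ : DecidableEquality Ty
bool    ≟T bool    = yes refl
bool    ≟T (_ ⊗ _) = no λ ()
bool    ≟T (_ ⊸ _) = no λ ()
(_ ⊗ _) ≟T bool    = no λ ()
(_ ⊗ _) ≟T (_ ⊸ _) = no λ ()
(_ ⊸ _) ≟T bool    = no λ ()
(_ ⊸ _) ≟T (_ ⊗ _) = no λ ()
(A ⊗ B) ≟T (C ⊗ D) with A ≟T C | B ≟T D
... | yes refl | yes refl = yes refl
... | no n     | _        = no λ { refl → n refl }
... | yes _    | no n     = no λ { refl → n refl }
(A ⊸ B) ≟T (C ⊸ D) with A ≟T C | B ≟T D
... | yes refl | yes refl = yes refl
... | no n     | _        = no λ { refl → n refl }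
... | yes _    | no n     = no λ { refl → n refl }

-- codomain of an arrow type (junk value bool otherwise)
codT : Ty → Ty
codT (A ⊸ B) = B
codT _       = bool

∣_∣ : Ty → Set
∣ bool ∣  = Bool
∣ A ⊗ B ∣ = ∣ A ∣ × ∣ B ∣
∣ A ⊸ B ∣ = ∣ A ∣ × ∣ B ∣

enum : (A : Ty) → List ∣ A ∣
enum bool    = true ∷ false ∷ []
enum (A ⊗ B) = concatMap (λ x → map (x ,_) (enum B)) (enum A)
enum (A ⊸ B) = concatMap (λ x → map (x ,_) (enum B)) (enum A)

eqW : (A : Ty) → ∣ A ∣ → ∣ A ∣ → Bool
eqW bool    x y = does (x B.≟ y)
eqW (A ⊗ B) (x , y) (x' , y') = eqW A x x' ∧ eqW B y y'
eqW (A ⊸ B) (x , y) (x' , y') = eqW A x x' ∧ eqW B y y'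

-- default web element and type coercion (identity when the types agree;
-- only used at equal types for well-typed terms)
dflt : (A : Ty) → ∣ A ∣
dflt bool    = true
dflt (A ⊗ B) = dflt A , dflt B
dflt (A ⊸ B) = dflt A , dflt B

coe : (A B : Ty) → ∣ A ∣ → ∣ B ∣
coe A B x with A ≟T B
... | yes refl = x
... | no _     = dflt B

record Var : Set where
  constructor mkVar
  field
    name : ℕ
    ty   : Ty
open Var public

_≟V_ : DecidableEquality Var
mkVar n A ≟V mkVar m C with n N.≟ m | A ≟T C
... | yes refl | yes refl = yes refl
... | no k     | _        = no λ { refl → k refl }
... | yes _    | no k     = no λ { refl → k refl }

VarOK : Var → Set
VarOK v = T (isPos (ty v) ∨ isArr (ty v))

-- finite sets of variables are represented by lists (order/duplicates irrelevant)
_∈ᵇ_ : Var → List Var → Bool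
v ∈ᵇ xs = any (λ w → does (v ≟V w)) xs

_∖_ : List Var → List Var → List Var
xs ∖ ys = filter (λ v → T? (not (v ∈ᵇ ys))) xs
  where open import Data.Bool.Properties using (T?)

_∩_ : List Var → List Var → List Var
xs ∩ ys = filter (λ v → T? (v ∈ᵇ ys)) xs
  where open import Data.Bool.Properties using (T?)

Disjoint : List Var → List Var → Set
Disjoint xs ys = ∀ v → v ∈ xs → v ∈ ys → ⊥

-- environments: total assignments; an element a ∈ |V| is represented by any
-- environment, only its values on V being relevant.
Env : Set
Env = (v : Var) → ∣ ty v ∣

upd : Env → (v : Var) → ∣ ty v ∣ → Env
upd ρ v x w with w ≟V v
... | yes refl = x
... | no _     = ρ w

data Pat : Set where
  pv : Var → Pat
  pp : Pat → Pat → Pat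

pvars : Pat → List Var
pvars (pv v)   = v ∷ []
pvars (pp p q) = pvars p ++ pvars q

ptype : Pat → Ty
ptype (pv v)   = ty v
ptype (pp p q) = ptype p ⊗ ptype q

-- the identification |FV(p)| ≅ |ty(p)| via the tuple structure of p
tuple : (p : Pat) → Env → ∣ ptype p ∣
tuple (pv v)   ρ = ρ v
tuple (pp p q) ρ = tuple p ρ , tuple q ρ

bindPat : (p : Pat) → ∣ ptype p ∣ → Env → Env
bindPat (pv v)   x       ρ = upd ρ v x
bindPat (pp p q) (x , y) ρ = bindPat q y (bindPat p x ρ)

data PTyped : Pat → Ty → Set where
  pvarT  : ∀ {v} → VarOK v → PTyped (pv v) (ty v)
  ppairT : ∀ {p q A B} → PTyped p A → IsPos A → PTyped q B →
           Disjoint (pvars p) (pvars q) → PTyped (pp p q) (A ⊗ B)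

-- first arrow variable of a pattern (a well-typed pattern has at most one)
arrVar : List Var → Maybe Var
arrVar []       = nothing
arrVar (v ∷ vs) = if isArr (ty v) then just v else arrVar vs

-- Everything involving scalars is parametrised by a commutative semiring
-- (the paper's scalars are ℝ≥0, itself a commutative semiring).

module Sem {c r : Level} (R : CommutativeSemiring c r) where
  open CommutativeSemiring R public renaming (Carrier to K)

  sumL : ∀ {X : Set} → (X → K) → List X → K
  sumL g = foldr (λ x s → g x + s) 0#

  δ : Bool → K
  δ true  = 1#
  δ false = 0#

  record Mat : Set c where
    constructor mkMat
    field
      dom cod : Ty
      mat     : ∣ dom ∣ → ∣ cod ∣ → K

  record Vec0 : Set c where
    constructor mkVec0
    field
      cod0 : Ty
      vec  : ∣ cod0 ∣ → K

  open Mat public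
  open Vec0 public

  Stochastic : Mat → Set r
  Stochastic M = ∀ a → sumL (mat M a) (enum (cod M)) ≈ 1#

  Stochastic0 : Vec0 → Set r
  Stochastic0 M = sumL (vec M) (enum (cod0 M)) ≈ 1#

  data Exp : Set c where
    var  : Var → Exp
    cst  : Mat → Pat → Exp
    cst0 : Vec0 → Exp
    app  : Var → Pat → Exp
    pair : Exp → Exp → Exp
    lam  : Pat → Exp → Exp
    let′ : Pat → Exp → Exp → Exp

  FV : Exp → List Var
  FV (var v)       = v ∷ []
  FV (cst M x)     = pvars x
  FV (cst0 M)      = []
  FV (app f x)     = f ∷ pvars x
  FV (pair e e')   = FV e ++ FV e'
  FV (lam x e)     = FV e ∖ pvars x
  FV (let′ p e e') = FV e ++ (FV e' ∖ pvars p)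

  FVa : Exp → List Var
  FVa e = filter (λ v → T? (isArr (ty v))) (FV e)
    where open import Data.Bool.Properties using (T?)

  infer : Exp → Ty
  infer (var v)       = ty v
  infer (cst M x)     = cod M
  infer (cst0 M)      = cod0 M
  infer (app f x)     = codT (ty f)
  infer (pair e e')   = infer e ⊗ infer e'
  infer (lam x e)     = ptype x ⊸ infer e
  infer (let′ p e e') = infer e'

  data Typed : Exp → Ty → Set (c ⊔ r) where
    varT  : ∀ {v} → VarOK v → Typed (var v) (ty v)
    appT  : ∀ {f x A B} → VarOK f → ty f ≡ (A ⊸ B) → PTyped x A → IsPos A →
            Typed (app f x) B
    cstT  : ∀ {M x} → Stochastic M → IsPos (dom M) → IsPos (cod M) →
            PTyped x (dom M) → Typed (cst M x) (cod M)
    cst0T : ∀ {M} → Stochastic0 M → IsPos (cod0 M) → Typed (cst0 M) (cod0 M)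
    lamT  : ∀ {x e A B} → PTyped x A → IsPos A → Typed e B →
            Typed (lam x e) (A ⊸ B)
    pairT : ∀ {e e' A B} → Typed e A → IsPos A → Typed e' B →
            Disjoint (FVa e) (FVa e') → Typed (pair e e') (A ⊗ B)
    letT  : ∀ {p e e' A B} → PTyped p A → Typed e A → Typed e' B →
            Disjoint (FVa e) (FVa e') →
            (∀ f → f ∈ pvars p → IsArr (ty f) → f ∈ FVa e') →
            Typed (let′ p e e') B

  sumW : (A : Ty) → (∣ A ∣ → K) → K
  sumW A g = sumL g (enum A)

  sumOverL : List Var → (Env → K) → Env → K
  sumOverL []       f ρ = f ρ
  sumOverL (v ∷ vs) f ρ = sumW (ty v) (λ x → sumOverL vs f (upd ρ v x))

  sumOver : List Var → (Env → K) → Env → K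
  sumOver S = sumOverL (deduplicate _≟V_ S)

  appSem : (A : Ty) → ∣ A ∣ → (X : Ty) → ∣ X ∣ → ∣ codT A ∣ → K
  appSem (A ⊸ B) (a' , a'') X a''' b = δ (eqA A X a' a''') * δ (eqW B a'' b)
    where
      eqA : (A X : Ty) → ∣ A ∣ → ∣ X ∣ → Bool
      eqA A X a x with A ≟T X
      ... | yes refl = eqW A a x
      ... | no _     = false
  appSem bool    _ _ _ _ = 0#
  appSem (_ ⊗ _) _ _ _ _ = 0#

  -- [[ e ]]_{a,b}, a given as an environment (only a|FV(e) matters)
  ⟦_⟧ : (e : Exp) → Env → ∣ infer e ∣ → K
  ⟦ var v ⟧       ρ b        = δ (eqW (ty v) (ρ v) b)
  ⟦ cst M x ⟧     ρ b        = mat M (coe (ptype x) (dom M) (tuple x ρ)) b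
  ⟦ cst0 M ⟧      ρ b        = vec M b
  ⟦ app f x ⟧     ρ b        = appSem (ty f) (ρ f) (ptype x) (tuple x ρ) b
  ⟦ pair e e' ⟧   ρ (b , b') = ⟦ e ⟧ ρ b * ⟦ e' ⟧ ρ b'
  ⟦ lam x e ⟧     ρ (b , b') = ⟦ e ⟧ (bindPat x b ρ) b'
  ⟦ let′ p e e' ⟧ ρ b        =
    sumOver (pvars p) (λ σ → ⟦ e ⟧ ρ (coe (ptype p) (infer e) (tuple p σ)) * ⟦ e' ⟧ σ b) ρ

  data LetTerm : Set c where
    out : Pat → LetTerm
    lett : Pat → Exp → LetTerm → LetTerm

  patExp : Pat → Exp
  patExp (pv v)   = var v
  patExp (pp p q) = pair (patExp p) (patExp q)

  toExp : LetTerm → Exp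
  toExp (out p)      = patExp p
  toExp (lett p e l) = let′ p e (toExp l)

  output : LetTerm → Pat
  output (out p)      = p
  output (lett _ _ l) = output l

  boundVars : LetTerm → List Var
  boundVars (out p)      = []
  boundVars (lett p e l) = pvars p ++ boundVars l

  record Factor : Set c where
    constructor factor
    field
      vars : List Var
      fn   : Env → K        -- φ(a), depending only on a|vars
  open Factor public

  ΣF : List Var → Factor → Factor
  ΣF S φ = factor (vars φ ∖ S) (sumOver (S ∩ vars φ) (fn φ))

  _⊙_ : Factor → Factor → Factor
  φ ⊙ ψ = factor (vars φ ++ vars ψ) (λ ρ → fn φ ρ * fn ψ ρ)

  unitF : Factor
  unitF = factor [] (λ _ → 1#)

  ⨀ : List Factor → Factor
  ⨀ = foldr _⊙_ unitF

  VarΓ : List Factor → List Var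
  VarΓ = concatMap vars

  touches : List Var → Factor → Bool
  touches V φ = any (λ v → v ∈ᵇ V) (vars φ)

  Γ[_] : List Factor → List Var → List Factor
  Γ[ Γ ] V = filter (λ φ → T? (touches V φ)) Γ
    where open import Data.Bool.Properties using (T?)

  Γ¬[_] : List Factor → List Var → List Factor
  Γ¬[ Γ ] V = filter (λ φ → T? (not (touches V φ))) Γ
    where open import Data.Bool.Properties using (T?)

  Fact : Pat → Exp → Factor
  Fact p e = factor (FV e ++ pvars p)
                    (λ ρ → ⟦ e ⟧ ρ (coe (ptype p) (infer e) (tuple p ρ)))

  Facts : LetTerm → List Factor
  Facts (out w) = factor (pvars w) (λ _ → 1#) ∷ []
  Facts (lett p e l) with arrVar (pvars p)
  ... | nothing = Fact p e ∷ Facts l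
  ... | just f  =
    if f ∈ᵇ pvars (output l)
    then Fact p e ∷ Facts l
    else (ΣF (f ∷ []) (Fact p e ⊙ ⨀ (Γ[ Facts l ] (f ∷ [])))
           ∷ Γ¬[ Facts l ] (f ∷ []))

  -- a' ⊎ c ⊎ b' as an environment: a on FV(ℓ), b elsewhere
  merge : List Var → Env → Env → Env
  merge V a b v = if v ∈ᵇ V then a v else b v

  -- [[ℓ]]_{a,b}, with b ∈ |FV(v⃗)| read as an element of |ty(v⃗)| via tuple
  ⟦_⟧L : LetTerm → Env → Env → K
  ⟦ l ⟧L a b = ⟦ toExp l ⟧ a (coe (ptype (output l)) (infer (toExp l)) (tuple (output l) b))

  Agree : LetTerm → Env → Env → Set
  Agree l a b = ∀ v → v ∈ FV (toExp l) → v ∈ pvars (output l) → a v ≡ b v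

-- Unfolding the nested lets, [[ℓ]]_{a,b} is one sum, over all bound variables, of the product of
-- the definition factors Fact(v⃗ᵢ = eᵢ) times the Kronecker delta comparing the output pattern
-- with b. The product of Facts(ℓ) is the same product, except that the arrow variable of each
-- definition not used in the output has already been summed out; since a sum over a variable
-- commutes with all factors not mentioning it, it equals the product of the definition factors
-- summed over these arrow variables. In the big sum the delta pins every bound output variable
-- to its value in b and turns the free output variables into the test that a and b agree on
-- FV(ℓ) ∩ FV(v⃗). What is left is a sum over the bound variables that are not output, and these
-- are exactly the variables of Facts(ℓ) outside FV(ℓ) ∪ FV(v⃗).

module Submission where

open import Defs
open import Level using (Level)
open import Function using (_∘_; id; case_of_)
open import Function.Bundles using (mk⇔)
open import Algebra.Bundles using (CommutativeSemiring)
open import Relation.Nullary using (¬_; yes; no; does)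
open import Relation.Binary.PropositionalEquality using (_≡_; _≢_; refl; sym; trans; cong; cong₂; subst)
open import Data.Bool using (Bool; true; false; _∧_; _∨_; not; T; if_then_else_)
open import Data.Bool.Properties using (T?; ∧-conicalˡ; ∧-conicalʳ; ¬-not)
open import Data.Empty using (⊥-elim)
open import Data.Unit using (⊤; tt)
open import Data.Maybe using (Maybe; just; nothing)
open import Data.Product as Product using (_×_; _,_; proj₁; proj₂)
open import Data.Sum as Sum using (_⊎_; inj₁; inj₂; [_,_]′)
open import Data.List using (List; []; _∷_; _++_; map; concatMap; filter; deduplicate; fromMaybe)
open import Data.List.Properties using (++-identityʳ)
open import Data.List.Membership.Propositional using (_∈_; _∉_)
open import Data.List.Membership.Propositional.Properties
  using (∈-++⁺ˡ; ∈-++⁺ʳ; ∈-++⁻; ∈-filter⁺; ∈-filter⁻; ∈-deduplicate⁺; ∈-deduplicate⁻)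
open import Data.List.Membership.Propositional.Properties.WithK using (unique∧set⇒bag)
open import Data.List.Membership.DecPropositional _≟V_ using (_∈?_)
open import Data.List.Relation.Unary.Any as Any using (here; there)
open import Data.List.Relation.Unary.Any.Properties using (any⁺; ¬Any[])
open import Data.List.Relation.Unary.All using (All; []; _∷_)
import Data.List.Relation.Unary.All as All
import Data.List.Relation.Unary.All.Properties as All
open import Data.List.Relation.Unary.Unique.Propositional using (Unique; []; _∷_)
import Data.List.Relation.Unary.Unique.Propositional.Properties as Unique
open import Data.List.Relation.Unary.Unique.DecPropositional.Properties _≟V_ using (deduplicate-!)
open import Data.List.Relation.Binary.Permutation.Propositional as ↭ using (_↭_)
open import Data.List.Relation.Binary.BagAndSetEquality using (∼bag⇒↭)

-- Environments, membership and patterns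

_≐_ : Env → Env → Set
ρ ≐ ρ′ = ∀ v → ρ v ≡ ρ′ v

EqOn : (Var → Set) → Env → Env → Set
EqOn P ρ ρ′ = ∀ {v} → P v → ρ v ≡ ρ′ v

upd-≡ : ∀ ρ v x → upd ρ v x v ≡ x
upd-≡ ρ v x with v ≟V v
... | yes refl = refl
... | no v≢v   = ⊥-elim (v≢v refl)

upd-≢ : ∀ ρ v x {w} → w ≢ v → upd ρ v x w ≡ ρ w
upd-≢ ρ v x {w} w≢v with w ≟V v
... | yes w≡v = ⊥-elim (w≢v w≡v)
... | no _    = refl

upd-cong : ∀ {P} ρ ρ′ v x → (∀ {w} → w ≢ v → P w → ρ w ≡ ρ′ w) → EqOn P (upd ρ v x) (upd ρ′ v x)
upd-cong ρ ρ′ v x eq {w} pw with w ≟V v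
... | yes refl = refl
... | no w≢v   = eq w≢v pw

upd-self : ∀ ρ v → upd ρ v (ρ v) ≐ ρ
upd-self ρ v w with w ≟V v
... | yes refl = refl
... | no _     = refl

upd-comm : ∀ ρ {u v} x y → u ≢ v → upd (upd ρ u x) v y ≐ upd (upd ρ v y) u x
upd-comm ρ {u} {v} x y u≢v w with w ≟V v | w ≟V u
... | yes refl | yes refl = ⊥-elim (u≢v refl)
... | yes refl | no _     = sym (upd-≡ ρ v y)
... | no _     | yes refl = upd-≡ ρ u x
... | no w≢v   | no w≢u   = trans (upd-≢ ρ u x w≢u) (sym (upd-≢ ρ v y w≢v))

∈ᵇ≡does : ∀ v xs → v ∈ᵇ xs ≡ does (v ∈? xs)
∈ᵇ≡does v []       = refl
∈ᵇ≡does v (w ∷ ws) = cong (does (v ≟V w) ∨_) (∈ᵇ≡does v ws)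

∈ᵇ-true : ∀ {v xs} → v ∈ xs → v ∈ᵇ xs ≡ true
∈ᵇ-true {v} {xs} v∈ rewrite ∈ᵇ≡does v xs with v ∈? xs
... | yes _  = refl
... | no v∉ = ⊥-elim (v∉ v∈)

∈ᵇ-false : ∀ {v xs} → v ∉ xs → v ∈ᵇ xs ≡ false
∈ᵇ-false {v} {xs} v∉ rewrite ∈ᵇ≡does v xs with v ∈? xs
... | yes v∈ = ⊥-elim (v∉ v∈)
... | no _   = refl

∈ᵇ-sound : ∀ {v} xs → T (v ∈ᵇ xs) → v ∈ xs
∈ᵇ-sound {v} xs t rewrite ∈ᵇ≡does v xs with v ∈? xs
... | yes v∈ = v∈

∈-∖⁺ : ∀ {v xs} ys → v ∈ xs → v ∉ ys → v ∈ xs ∖ ys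
∈-∖⁺ ys v∈ v∉ = ∈-filter⁺ (λ u → T? (not (u ∈ᵇ ys))) v∈ (subst (T ∘ not) (sym (∈ᵇ-false v∉)) tt)

∈-∖⁻ : ∀ {v} xs ys → v ∈ xs ∖ ys → v ∈ xs × v ∉ ys
∈-∖⁻ xs ys v∈ with ∈-filter⁻ (λ u → T? (not (u ∈ᵇ ys))) {xs = xs} v∈
... | v∈xs , t = v∈xs , λ v∈ys → subst (T ∘ not) (∈ᵇ-true v∈ys) t

∈-∩⁺ : ∀ {v xs ys} → v ∈ xs → v ∈ ys → v ∈ xs ∩ ys
∈-∩⁺ {ys = ys} v∈xs v∈ys = ∈-filter⁺ (λ u → T? (u ∈ᵇ ys)) v∈xs (subst T (sym (∈ᵇ-true v∈ys)) tt)

∈-∩⁻ : ∀ {v} xs ys → v ∈ xs ∩ ys → v ∈ xs × v ∈ ys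
∈-∩⁻ xs ys v∈ with ∈-filter⁻ (λ u → T? (u ∈ᵇ ys)) {xs = xs} v∈
... | v∈xs , t = v∈xs , ∈ᵇ-sound ys t

Unique-++⁻ : ∀ xs {ys : List Var} → Unique (xs ++ ys) → Unique xs × Unique ys × Disjoint xs ys
Unique-++⁻ []       u        = [] , u , λ _ ()
Unique-++⁻ (x ∷ xs) (x∉ ∷ u) with Unique-++⁻ xs u
... | uxs , uys , xs#ys =
  All.tabulate (λ m → All.lookup x∉ (∈-++⁺ˡ m)) ∷ uxs , uys ,
  λ { v (here refl) m → All.lookup x∉ (∈-++⁺ʳ xs m) refl ; v (there k) m → xs#ys v k m }

unique-sameElements⇒↭ : ∀ {xs ys : List Var} → Unique xs → Unique ys →
  (∀ {v} → v ∈ xs → v ∈ ys) → (∀ {v} → v ∈ ys → v ∈ xs) → xs ↭ ys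
unique-sameElements⇒↭ uxs uys to from = ∼bag⇒↭ (unique∧set⇒bag uxs uys (mk⇔ to from))

tuple-cong : ∀ p {ρ ρ′} → EqOn (_∈ pvars p) ρ ρ′ → tuple p ρ ≡ tuple p ρ′
tuple-cong (pv v)   eq = eq (here refl)
tuple-cong (pp p q) eq =
  cong₂ _,_ (tuple-cong p (λ m → eq (∈-++⁺ˡ m))) (tuple-cong q (λ m → eq (∈-++⁺ʳ (pvars p) m)))

bindPat-cong : ∀ {P ρ ρ′} p x → EqOn P ρ ρ′ → EqOn (λ w → P w ⊎ w ∈ pvars p) (bindPat p x ρ) (bindPat p x ρ′)
bindPat-cong {P} {ρ} {ρ′} (pv v) x eq =
  upd-cong {λ u → P u ⊎ u ∈ v ∷ []} ρ ρ′ v x λ { _ (inj₁ pw) → eq pw ; w≢v (inj₂ (here w≡v)) → ⊥-elim (w≢v w≡v) }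
bindPat-cong {P} (pp p q) (x , y) eq {w} m = bindPat-cong q y (bindPat-cong p x eq) (regroup m)
  where
  regroup : P w ⊎ w ∈ pvars p ++ pvars q → (P w ⊎ w ∈ pvars p) ⊎ w ∈ pvars q
  regroup (inj₁ pw) = inj₁ (inj₁ pw)
  regroup (inj₂ w∈) = [ inj₁ ∘ inj₂ , inj₂ ]′ (∈-++⁻ (pvars p) w∈)

coe-refl : ∀ A x → coe A A x ≡ x
coe-refl A x with A ≟T A
... | yes refl = refl
... | no A≢A   = ⊥-elim (A≢A refl)

coe-⊗ : ∀ {A A′ C C′} x y → A ≡ A′ → C ≡ C′ → coe (A ⊗ C) (A′ ⊗ C′) (x , y) ≡ (coe A A′ x , coe C C′ y)
coe-⊗ {A} {_} {C} x y refl refl =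
  trans (coe-refl (A ⊗ C) (x , y)) (sym (cong₂ _,_ (coe-refl A x) (coe-refl C y)))

eqW-refl : ∀ A x → eqW A x x ≡ true
eqW-refl bool    true    = refl
eqW-refl bool    false   = refl
eqW-refl (A ⊗ C) (x , y) = cong₂ _∧_ (eqW-refl A x) (eqW-refl C y)
eqW-refl (A ⊸ C) (x , y) = cong₂ _∧_ (eqW-refl A x) (eqW-refl C y)

eqW-sound : ∀ A x y → eqW A x y ≡ true → x ≡ y
eqW-sound bool    true     true      _  = refl
eqW-sound bool    false    false     _  = refl
eqW-sound (A ⊗ C) (x , x′) (y , y′) eq =
  cong₂ _,_ (eqW-sound A x y (∧-conicalˡ _ _ eq)) (eqW-sound C x′ y′ (∧-conicalʳ _ _ eq))
eqW-sound (A ⊸ C) (x , x′) (y , y′) eq =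
  cong₂ _,_ (eqW-sound A x y (∧-conicalˡ _ _ eq)) (eqW-sound C x′ y′ (∧-conicalʳ _ _ eq))

matches : Pat → Env → Env → Bool
matches (pv v)   τ b = eqW (ty v) (τ v) (b v)
matches (pp p q) τ b = matches p τ b ∧ matches q τ b

matches-cong : ∀ w {τ τ′} b → EqOn (_∈ pvars w) τ τ′ → matches w τ b ≡ matches w τ′ b
matches-cong (pv v)   b eq = cong (λ t → eqW (ty v) t (b v)) (eq (here refl))
matches-cong (pp p q) b eq =
  cong₂ _∧_ (matches-cong p b (λ m → eq (∈-++⁺ˡ m))) (matches-cong q b (λ m → eq (∈-++⁺ʳ (pvars p) m)))

matches-complete : ∀ w {τ b} → EqOn (_∈ pvars w) τ b → matches w τ b ≡ true
matches-complete (pv v) {b = b} eq rewrite eq (here refl) = eqW-refl (ty v) (b v)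
matches-complete (pp p q) eq =
  cong₂ _∧_ (matches-complete p (λ m → eq (∈-++⁺ˡ m))) (matches-complete q (λ m → eq (∈-++⁺ʳ (pvars p) m)))

matches-sound : ∀ w {τ b} → matches w τ b ≡ true → EqOn (_∈ pvars w) τ b
matches-sound (pv v) {τ} {b} eq (here refl) = eqW-sound (ty v) (τ v) (b v) eq
matches-sound (pp p q) eq m with ∈-++⁻ (pvars p) m
... | inj₁ m∈p = matches-sound p (∧-conicalˡ _ _ eq) m∈p
... | inj₂ m∈q = matches-sound q (∧-conicalʳ _ _ eq) m∈q

arrVar-∈ : ∀ xs {f} → arrVar xs ≡ just f → f ∈ xs
arrVar-∈ (v ∷ vs) eq with isArr (ty v)
arrVar-∈ (v ∷ vs) refl | true  = here refl
arrVar-∈ (v ∷ vs) eq   | false = there (arrVar-∈ vs eq)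

fromMaybe-unique : ∀ (h : Maybe Var) → Unique (fromMaybe h)
fromMaybe-unique nothing  = []
fromMaybe-unique (just f) = [] ∷ []

module _ {c r : Level} (R : CommutativeSemiring c r) where

  open Sem R renaming (refl to ≈-refl; sym to ≈-sym; trans to ≈-trans)
  open import Algebra.Properties.CommutativeSemigroup +-commutativeSemigroup using (interchange)
  open import Algebra.Properties.CommutativeSemigroup *-commutativeSemigroup using (x∙yz≈y∙xz)
  open import Relation.Binary.Reasoning.Setoid setoid

  -- Sums over webs and over assignments of variables

  sumL-cong : ∀ {X : Set} {g h : X → K} xs → (∀ x → g x ≈ h x) → sumL g xs ≈ sumL h xs
  sumL-cong []       eq = ≈-refl
  sumL-cong (x ∷ xs) eq = +-cong (eq x) (sumL-cong xs eq)

  sumL-*ˡ : ∀ {X : Set} k (g : X → K) xs → k * sumL g xs ≈ sumL (λ x → k * g x) xs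
  sumL-*ˡ k g []       = zeroʳ k
  sumL-*ˡ k g (x ∷ xs) = ≈-trans (distribˡ k (g x) (sumL g xs)) (+-cong ≈-refl (sumL-*ˡ k g xs))

  sumL-*ʳ : ∀ {X : Set} k (g : X → K) xs → sumL g xs * k ≈ sumL (λ x → g x * k) xs
  sumL-*ʳ k g xs = ≈-trans (*-comm _ k) (≈-trans (sumL-*ˡ k g xs) (sumL-cong xs λ x → *-comm k (g x)))

  sumL-+ : ∀ {X : Set} (g h : X → K) xs → sumL (λ x → g x + h x) xs ≈ sumL g xs + sumL h xs
  sumL-+ g h []       = ≈-sym (+-identityˡ 0#)
  sumL-+ g h (x ∷ xs) = ≈-trans (+-cong ≈-refl (sumL-+ g h xs)) (interchange (g x) (h x) (sumL g xs) (sumL h xs))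

  sumL-0# : ∀ {X : Set} (xs : List X) → sumL (λ _ → 0#) xs ≈ 0#
  sumL-0# []       = ≈-refl
  sumL-0# (x ∷ xs) = ≈-trans (+-identityˡ _) (sumL-0# xs)

  sumL-comm : ∀ {X Y : Set} (g : X → Y → K) xs ys →
    sumL (λ x → sumL (g x) ys) xs ≈ sumL (λ y → sumL (λ x → g x y) xs) ys
  sumL-comm g []       ys = ≈-sym (sumL-0# ys)
  sumL-comm g (x ∷ xs) ys =
    ≈-trans (+-cong ≈-refl (sumL-comm g xs ys)) (≈-sym (sumL-+ (g x) (λ y → sumL (λ x → g x y) xs) ys))

  sumL-++ : ∀ {X : Set} (g : X → K) xs ys → sumL g (xs ++ ys) ≈ sumL g xs + sumL g ys
  sumL-++ g []       ys = ≈-sym (+-identityˡ _)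
  sumL-++ g (x ∷ xs) ys = ≈-trans (+-cong ≈-refl (sumL-++ g xs ys)) (≈-sym (+-assoc _ _ _))

  sumL-pairs : ∀ {X Y : Set} (g : X × Y → K) xs ys →
    sumL g (concatMap (λ x → map (x ,_) ys) xs) ≈ sumL (λ x → sumL (λ y → g (x , y)) ys) xs
  sumL-pairs g []       ys = ≈-refl
  sumL-pairs g (x ∷ xs) ys = ≈-trans (sumL-++ g (map (x ,_) ys) _) (+-cong (sumL-map ys) (sumL-pairs g xs ys))
    where
    sumL-map : ∀ ys → sumL g (map (x ,_) ys) ≈ sumL (λ y → g (x , y)) ys
    sumL-map []       = ≈-refl
    sumL-map (y ∷ ys) = +-cong ≈-refl (sumL-map ys)

  δ-∧ : ∀ a b → δ (a ∧ b) ≈ δ a * δ b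
  δ-∧ true  b = ≈-sym (*-identityˡ _)
  δ-∧ false b = ≈-sym (zeroˡ _)

  sumW-δ : ∀ A (g : ∣ A ∣ → K) y → sumW A (λ x → δ (eqW A x y) * g x) ≈ g y
  sumW-δ-⊗ : ∀ A C (g : ∣ A ⊗ C ∣ → K) y → sumW (A ⊗ C) (λ x → δ (eqW (A ⊗ C) x y) * g x) ≈ g y

  sumW-δ bool g true = begin
    1# * g true + (0# * g false + 0#) ≈⟨ +-cong (*-identityˡ _) (≈-trans (+-identityʳ _) (zeroˡ _)) ⟩
    g true + 0#                       ≈⟨ +-identityʳ _ ⟩
    g true                            ∎
  sumW-δ bool g false = begin
    0# * g true + (1# * g false + 0#) ≈⟨ +-cong (zeroˡ _) (≈-trans (+-identityʳ _) (*-identityˡ _)) ⟩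
    0# + g false                      ≈⟨ +-identityˡ _ ⟩
    g false                           ∎
  sumW-δ (A ⊗ C) = sumW-δ-⊗ A C
  -- A ⊸ C and A ⊗ C have the same web, enumeration and equality test.
  sumW-δ (A ⊸ C) = sumW-δ-⊗ A C

  sumW-δ-⊗ A C g (y₁ , y₂) = begin
    sumW (A ⊗ C) (λ x → δ (eqW (A ⊗ C) x (y₁ , y₂)) * g x)
      ≈⟨ sumL-pairs _ (enum A) (enum C) ⟩
    sumW A (λ x₁ → sumW C (λ x₂ → δ (eqW A x₁ y₁ ∧ eqW C x₂ y₂) * g (x₁ , x₂)))
      ≈⟨ sumL-cong (enum A) (λ x₁ → ≈-sym (≈-trans (sumL-*ˡ _ _ (enum C)) (sumL-cong (enum C) λ x₂ →
           ≈-trans (≈-sym (*-assoc _ _ _)) (*-cong (≈-sym (δ-∧ (eqW A x₁ y₁) (eqW C x₂ y₂))) ≈-refl)))) ⟩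
    sumW A (λ x₁ → δ (eqW A x₁ y₁) * sumW C (λ x₂ → δ (eqW C x₂ y₂) * g (x₁ , x₂)))
      ≈⟨ sumL-cong (enum A) (λ x₁ → *-cong ≈-refl (sumW-δ C (λ x₂ → g (x₁ , x₂)) y₂)) ⟩
    sumW A (λ x₁ → δ (eqW A x₁ y₁) * g (x₁ , y₂))
      ≈⟨ sumW-δ A (λ x₁ → g (x₁ , y₂)) y₁ ⟩
    g (y₁ , y₂) ∎

  DependsOn : (Var → Set) → (Env → K) → Set _
  DependsOn P f = ∀ ρ ρ′ → EqOn P ρ ρ′ → f ρ ≈ f ρ′

  Extensional : (Env → K) → Set _
  Extensional f = ∀ ρ ρ′ → ρ ≐ ρ′ → f ρ ≈ f ρ′

  DependsOn⇒Extensional : ∀ {P f} → DependsOn P f → Extensional f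
  DependsOn⇒Extensional dep ρ ρ′ eq = dep ρ ρ′ (λ {v} _ → eq v)

  sumOverL-cong : ∀ xs {f g : Env → K} ρ → (∀ σ → EqOn (_∉ xs) σ ρ → f σ ≈ g σ) →
    sumOverL xs f ρ ≈ sumOverL xs g ρ
  sumOverL-cong []       ρ eq = eq ρ (λ _ → refl)
  sumOverL-cong (v ∷ xs) ρ eq = sumL-cong (enum (ty v)) λ x → sumOverL-cong xs (upd ρ v x) λ σ σ≐ →
    eq σ λ w∉ → trans (σ≐ (λ w∈ → w∉ (there w∈))) (upd-≢ ρ v x (λ w≡v → w∉ (here w≡v)))

  sumOverL-local : ∀ xs {P f} → DependsOn P f → DependsOn (λ v → P v × v ∉ xs) (sumOverL xs f)
  sumOverL-local []       dep ρ ρ′ eq = dep ρ ρ′ λ pv → eq (pv , λ ())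
  sumOverL-local (v ∷ xs) {P} dep ρ ρ′ eq = sumL-cong (enum (ty v)) λ x →
    sumOverL-local xs dep (upd ρ v x) (upd ρ′ v x)
      (upd-cong {λ u → P u × u ∉ xs} ρ ρ′ v x λ w≢v (pw , w∉xs) →
        eq (pw , λ { (here w≡v) → w≢v w≡v ; (there w∈xs) → w∉xs w∈xs }))

  sumOverL-extensional : ∀ xs {f} → Extensional f → Extensional (sumOverL xs f)
  sumOverL-extensional xs ext ρ ρ′ eq =
    sumOverL-local xs {λ _ → ⊤} (λ σ σ′ σ≐ → ext σ σ′ (λ v → σ≐ tt)) ρ ρ′ (λ {v} _ → eq v)

  sumOverL-++ : ∀ xs ys f ρ → sumOverL (xs ++ ys) f ρ ≈ sumOverL xs (sumOverL ys f) ρ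
  sumOverL-++ []       ys f ρ = ≈-refl
  sumOverL-++ (v ∷ xs) ys f ρ = sumL-cong (enum (ty v)) λ x → sumOverL-++ xs ys f (upd ρ v x)

  sumOverL-*ˡ : ∀ xs k f ρ → k * sumOverL xs f ρ ≈ sumOverL xs (λ τ → k * f τ) ρ
  sumOverL-*ˡ []       k f ρ = ≈-refl
  sumOverL-*ˡ (v ∷ xs) k f ρ =
    ≈-trans (sumL-*ˡ k _ (enum (ty v))) (sumL-cong (enum (ty v)) λ x → sumOverL-*ˡ xs k f (upd ρ v x))

  sumOverL-*ˡ-local : ∀ xs {P g} f → DependsOn P g → (∀ {v} → v ∈ xs → ¬ P v) → ∀ ρ →
    g ρ * sumOverL xs f ρ ≈ sumOverL xs (λ τ → g τ * f τ) ρ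
  sumOverL-*ˡ-local xs {g = g} f dep xs#P ρ = ≈-trans (sumOverL-*ˡ xs (g ρ) f ρ) (sumOverL-cong xs ρ λ τ τ≐ρ →
    *-cong (dep ρ τ λ pv → sym (τ≐ρ λ v∈ → xs#P v∈ pv)) ≈-refl)

  sumOverL-swap : ∀ u v zs {f} → Extensional f → ∀ ρ → sumOverL (u ∷ v ∷ zs) f ρ ≈ sumOverL (v ∷ u ∷ zs) f ρ
  sumOverL-swap u v zs ext ρ with u ≟V v
  ... | yes refl = ≈-refl
  ... | no u≢v   = ≈-trans (sumL-comm _ (enum (ty u)) (enum (ty v)))
    (sumL-cong (enum (ty v)) λ y → sumL-cong (enum (ty u)) λ x →
      sumOverL-extensional zs ext _ _ (upd-comm ρ x y u≢v))

  sumOverL-↭ : ∀ {xs ys f} → xs ↭ ys → Extensional f → ∀ ρ → sumOverL xs f ρ ≈ sumOverL ys f ρ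
  sumOverL-↭ ↭.refl         ext ρ = ≈-refl
  sumOverL-↭ (↭.prep v p)   ext ρ = sumL-cong (enum (ty v)) λ x → sumOverL-↭ p ext (upd ρ v x)
  sumOverL-↭ {ys = _ ∷ _ ∷ ys} (↭.swap u v p) ext ρ = ≈-trans
    (sumL-cong (enum (ty u)) λ x → sumL-cong (enum (ty v)) λ y → sumOverL-↭ p ext _)
    (sumOverL-swap u v ys ext ρ)
  sumOverL-↭ (↭.trans p q)  ext ρ = ≈-trans (sumOverL-↭ p ext ρ) (sumOverL-↭ q ext ρ)

  sumOver≈sumOverL : ∀ xs {ys f} → Unique ys → (∀ {v} → v ∈ xs → v ∈ ys) → (∀ {v} → v ∈ ys → v ∈ xs) →
    Extensional f → ∀ ρ → sumOver xs f ρ ≈ sumOverL ys f ρ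
  sumOver≈sumOverL xs uys to from = sumOverL-↭ (unique-sameElements⇒↭ (deduplicate-! xs) uys
    (λ m → to (∈-deduplicate⁻ _≟V_ xs m)) (λ m → ∈-deduplicate⁺ _≟V_ (from m)))

  sumOverL-collapse : ∀ {xs} b {g} → Unique xs → Extensional g →
    (∀ {v} → v ∈ xs → ∀ τ → g τ ≈ δ (eqW (ty v) (τ v) (b v)) * g τ) →
    ∀ σ → EqOn (_∈ xs) σ b → sumOverL xs g σ ≈ g σ
  sumOverL-collapse b [] _ _ _ _ = ≈-refl
  sumOverL-collapse {v ∷ xs} b {g} (v∉ ∷ uxs) ext guard σ σ≐b = begin
    sumW (ty v) (λ x → sumOverL xs g (upd σ v x))
      ≈⟨ sumL-cong (enum (ty v)) (λ x → sumOverL-collapse b uxs ext (λ m → guard (there m)) (upd σ v x)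
           λ m → trans (upd-≢ σ v x λ w≡v → All.lookup v∉ m (sym w≡v)) (σ≐b (there m))) ⟩
    sumW (ty v) (λ x → g (upd σ v x))
      ≈⟨ sumL-cong (enum (ty v)) (λ x → ≈-trans (guard (here refl) (upd σ v x))
           (*-cong (reflexive (cong (λ t → δ (eqW (ty v) t (b v))) (upd-≡ σ v x))) ≈-refl)) ⟩
    sumW (ty v) (λ x → δ (eqW (ty v) x (b v)) * g (upd σ v x))
      ≈⟨ sumW-δ (ty v) (λ x → g (upd σ v x)) (b v) ⟩
    g (upd σ v (b v))
      ≈⟨ ext _ _ (subst (λ t → upd σ v t ≐ σ) (σ≐b (here refl)) (upd-self σ v)) ⟩
    g σ ∎

  δ-matches-guard : ∀ w {v} → v ∈ pvars w → ∀ τ b →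
    δ (matches w τ b) ≈ δ (eqW (ty v) (τ v) (b v)) * δ (matches w τ b)
  δ-matches-guard w {v} v∈ τ b with matches w τ b in eq
  ... | false = ≈-sym (zeroʳ _)
  ... | true rewrite matches-sound w eq v∈ | eqW-refl (ty v) (b v) = ≈-sym (*-identityˡ 1#)

  sumOverL-matches : ∀ w b xs {h} → Unique xs → Extensional h → ∀ ρ → EqOn (_∈ xs ∩ pvars w) ρ b →
    sumOverL xs (λ τ → h τ * δ (matches w τ b)) ρ ≈ δ (matches w ρ b) * sumOverL (xs ∖ pvars w) h ρ
  sumOverL-matches w b xs {h} uxs ext ρ ρ≐b = begin
    sumOverL xs g ρ
      ≈⟨ sumOverL-↭ xs↭ ext-g ρ ⟩
    sumOverL (xs ∖ O ++ xs ∩ O) g ρ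
      ≈⟨ sumOverL-++ (xs ∖ O) (xs ∩ O) g ρ ⟩
    sumOverL (xs ∖ O) (sumOverL (xs ∩ O) g) ρ
      ≈⟨ sumOverL-cong (xs ∖ O) ρ (λ σ σ≐ρ →
           sumOverL-collapse b u∩ ext-g guard σ λ m → trans (σ≐ρ (∩#∖ m)) (ρ≐b m)) ⟩
    sumOverL (xs ∖ O) g ρ
      ≈⟨ sumOverL-cong (xs ∖ O) ρ (λ σ σ≐ρ → ≈-trans (*-comm _ _)
           (*-cong (reflexive (cong δ (matches-cong w b λ v∈O → σ≐ρ λ v∈ → proj₂ (∈-∖⁻ xs O v∈) v∈O))) ≈-refl)) ⟩
    sumOverL (xs ∖ O) (λ σ → δ (matches w ρ b) * h σ) ρ
      ≈⟨ ≈-sym (sumOverL-*ˡ (xs ∖ O) _ h ρ) ⟩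
    δ (matches w ρ b) * sumOverL (xs ∖ O) h ρ ∎
    where
    O = pvars w
    g : Env → K
    g τ = h τ * δ (matches w τ b)
    ext-g : Extensional g
    ext-g τ τ′ eq = *-cong (ext τ τ′ eq) (reflexive (cong δ (matches-cong w b λ {v} _ → eq v)))
    guard : ∀ {v} → v ∈ xs ∩ O → ∀ τ → g τ ≈ δ (eqW (ty v) (τ v) (b v)) * g τ
    guard v∈ τ = ≈-trans (*-cong ≈-refl (δ-matches-guard w (proj₂ (∈-∩⁻ xs O v∈)) τ b)) (x∙yz≈y∙xz _ _ _)
    ∩#∖ : ∀ {v} → v ∈ xs ∩ O → v ∉ xs ∖ O
    ∩#∖ v∈∩ v∈∖ = proj₂ (∈-∖⁻ xs O v∈∖) (proj₂ (∈-∩⁻ xs O v∈∩))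
    u∖ : Unique (xs ∖ O)
    u∖ = Unique.filter⁺ _ uxs
    u∩ : Unique (xs ∩ O)
    u∩ = Unique.filter⁺ _ uxs
    xs↭ : xs ↭ xs ∖ O ++ xs ∩ O
    xs↭ = unique-sameElements⇒↭ uxs (Unique.++⁺ u∖ u∩ λ (m∖ , m∩) → ∩#∖ m∩ m∖)
      (λ {v} v∈ → case v ∈? O of λ
        { (yes v∈O) → ∈-++⁺ʳ (xs ∖ O) (∈-∩⁺ v∈ v∈O)
        ; (no v∉O)  → ∈-++⁺ˡ (∈-∖⁺ O v∈ v∉O) })
      (λ v∈ → [ (λ m → proj₁ (∈-∖⁻ xs O m)) , (λ m → proj₁ (∈-∩⁻ xs O m)) ]′ (∈-++⁻ (xs ∖ O) v∈))

  -- Locality of the semantics and of factors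

  ⟦⟧-local : ∀ e b → DependsOn (_∈ FV e) (λ ρ → ⟦ e ⟧ ρ b)
  ⟦⟧-local (var v)   b ρ ρ′ eq = reflexive (cong (λ t → δ (eqW (ty v) t b)) (eq (here refl)))
  ⟦⟧-local (cst M x) b ρ ρ′ eq = reflexive (cong (λ t → mat M (coe (ptype x) (dom M) t) b) (tuple-cong x eq))
  ⟦⟧-local (cst0 M)  b ρ ρ′ eq = ≈-refl
  ⟦⟧-local (app f x) b ρ ρ′ eq = reflexive (cong₂ (λ t s → appSem (ty f) t (ptype x) s b)
    (eq (here refl)) (tuple-cong x λ m → eq (there m)))
  ⟦⟧-local (pair e e′) (b , b′) ρ ρ′ eq =
    *-cong (⟦⟧-local e b ρ ρ′ λ m → eq (∈-++⁺ˡ m)) (⟦⟧-local e′ b′ ρ ρ′ λ m → eq (∈-++⁺ʳ (FV e) m))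
  ⟦⟧-local (lam x e) (b , b′) ρ ρ′ eq = ⟦⟧-local e b′ _ _ λ m → bindPat-cong x b eq (free-or-bound m)
    where
    free-or-bound : ∀ {v} → v ∈ FV e → v ∈ FV e ∖ pvars x ⊎ v ∈ pvars x
    free-or-bound {v} m with v ∈? pvars x
    ... | yes v∈x = inj₂ v∈x
    ... | no v∉x  = inj₁ (∈-∖⁺ (pvars x) m v∉x)
  ⟦⟧-local (let′ p e e′) b ρ ρ′ eq = begin
    sumOverL ps (body ρ) ρ  ≈⟨ sumOverL-cong ps ρ (λ σ _ → *-cong (⟦⟧-local e _ ρ ρ′ λ m → eq (∈-++⁺ˡ m)) ≈-refl) ⟩
    sumOverL ps (body ρ′) ρ ≈⟨ sumOverL-local ps body-local ρ ρ′ outside ⟩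
    sumOverL ps (body ρ′) ρ′ ∎
    where
    ps = deduplicate _≟V_ (pvars p)
    body : Env → Env → K
    body ρ σ = ⟦ e ⟧ ρ (coe (ptype p) (infer e) (tuple p σ)) * ⟦ e′ ⟧ σ b
    body-local : DependsOn (λ v → v ∈ pvars p ⊎ v ∈ FV e′) (body ρ′)
    body-local σ σ′ σ≐ = *-cong
      (reflexive (cong (λ t → ⟦ e ⟧ ρ′ (coe (ptype p) (infer e) t)) (tuple-cong p λ m → σ≐ (inj₁ m))))
      (⟦⟧-local e′ b σ σ′ λ m → σ≐ (inj₂ m))
    outside : EqOn (λ v → (v ∈ pvars p ⊎ v ∈ FV e′) × v ∉ ps) ρ ρ′
    outside (inj₁ v∈p , v∉ps) = ⊥-elim (v∉ps (∈-deduplicate⁺ _≟V_ v∈p))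
    outside (inj₂ v∈e′ , v∉ps) = eq (∈-++⁺ʳ (FV e) (∈-∖⁺ (pvars p) v∈e′ λ v∈p → v∉ps (∈-deduplicate⁺ _≟V_ v∈p)))

  Local : Factor → Set _
  Local φ = DependsOn (_∈ vars φ) (fn φ)

  Fact-local : ∀ p e → Local (Fact p e)
  Fact-local p e ρ ρ′ eq = ≈-trans (⟦⟧-local e _ ρ ρ′ λ m → eq (∈-++⁺ˡ m))
    (reflexive (cong (λ t → ⟦ e ⟧ ρ′ (coe (ptype p) (infer e) t)) (tuple-cong p λ m → eq (∈-++⁺ʳ (FV e) m))))

  vars-⨀ : ∀ Γ → vars (⨀ Γ) ≡ VarΓ Γ
  vars-⨀ []      = refl
  vars-⨀ (φ ∷ Γ) = cong (vars φ ++_) (vars-⨀ Γ)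

  ⊙-local : ∀ {φ ψ} → Local φ → Local ψ → Local (φ ⊙ ψ)
  ⊙-local {φ} lφ lψ ρ ρ′ eq = *-cong (lφ ρ ρ′ λ m → eq (∈-++⁺ˡ m)) (lψ ρ ρ′ λ m → eq (∈-++⁺ʳ (vars φ) m))

  ⨀-local : ∀ {Γ} → All Local Γ → Local (⨀ Γ)
  ⨀-local []          ρ ρ′ eq = ≈-refl
  ⨀-local (lφ ∷ lΓ) = ⊙-local lφ (⨀-local lΓ)

  ΣF-local : ∀ S {φ} → Local φ → Local (ΣF S φ)
  ΣF-local S {φ} lφ ρ ρ′ eq = sumOverL-local (deduplicate _≟V_ (S ∩ vars φ)) lφ ρ ρ′
    λ (v∈φ , v∉) → eq (∈-∖⁺ S v∈φ λ v∈S → v∉ (∈-deduplicate⁺ _≟V_ (∈-∩⁺ v∈S v∈φ)))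

  VarΓ-filter⁻ : ∀ (t : Factor → Bool) Γ {v} → v ∈ VarΓ (filter (T? ∘ t) Γ) → v ∈ VarΓ Γ
  VarΓ-filter⁻ t (φ ∷ Γ) m with t φ
  ... | true  = [ ∈-++⁺ˡ , (λ m₂ → ∈-++⁺ʳ (vars φ) (VarΓ-filter⁻ t Γ m₂)) ]′ (∈-++⁻ (vars φ) m)
  ... | false = ∈-++⁺ʳ (vars φ) (VarΓ-filter⁻ t Γ m)

  VarΓ-filter-split : ∀ (t : Factor → Bool) Γ {v} → v ∈ VarΓ Γ →
    v ∈ VarΓ (filter (T? ∘ t) Γ) ⊎ v ∈ VarΓ (filter (T? ∘ not ∘ t) Γ)
  VarΓ-filter-split t (φ ∷ Γ) m with t φ | ∈-++⁻ (vars φ) m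
  ... | true  | inj₁ m₁ = inj₁ (∈-++⁺ˡ m₁)
  ... | false | inj₁ m₁ = inj₂ (∈-++⁺ˡ m₁)
  ... | true  | inj₂ m₂ = Sum.map₁ (∈-++⁺ʳ (vars φ)) (VarΓ-filter-split t Γ m₂)
  ... | false | inj₂ m₂ = Sum.map₂ (∈-++⁺ʳ (vars φ)) (VarΓ-filter-split t Γ m₂)

  ⨀-filter-split : ∀ (t : Factor → Bool) Γ ρ →
    fn (⨀ (filter (T? ∘ t) Γ)) ρ * fn (⨀ (filter (T? ∘ not ∘ t) Γ)) ρ ≈ fn (⨀ Γ) ρ
  ⨀-filter-split t []      ρ = *-identityˡ 1#
  ⨀-filter-split t (φ ∷ Γ) ρ with t φ
  ... | true  = ≈-trans (*-assoc _ _ _) (*-cong ≈-refl (⨀-filter-split t Γ ρ))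
  ... | false = ≈-trans (x∙yz≈y∙xz _ _ _) (*-cong ≈-refl (⨀-filter-split t Γ ρ))

  touches-∈ : ∀ {V φ v} → v ∈ V → v ∈ vars φ → T (touches V φ)
  touches-∈ v∈V v∈φ = any⁺ _ (Any.map (λ { refl → subst T (sym (∈ᵇ-true v∈V)) tt }) v∈φ)

  ∉-VarΓ-untouched : ∀ Γ V {v} → v ∈ V → v ∉ VarΓ (Γ¬[ Γ ] V)
  ∉-VarΓ-untouched (φ ∷ Γ) V v∈V m with touches V φ in eq
  ... | true  = ∉-VarΓ-untouched Γ V v∈V m
  ... | false =
    [ (λ m₁ → subst T eq (touches-∈ {φ = φ} v∈V m₁)) , ∉-VarΓ-untouched Γ V v∈V ]′ (∈-++⁻ (vars φ) m)

  -- The factors contributed by one definition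

  -- The arrow variable f ∉ FV(w⃗) of a definition, which Facts sums out at once.
  summedArrow : Pat → LetTerm → Maybe Var
  summedArrow p l with arrVar (pvars p)
  ... | nothing = nothing
  ... | just f  = if f ∈ᵇ pvars (output l) then nothing else just f

  summedArrow-spec : ∀ p l {f} → f ∈ fromMaybe (summedArrow p l) → f ∈ pvars p × f ∉ pvars (output l)
  summedArrow-spec p l m with arrVar (pvars p) in eq
  summedArrow-spec p l () | nothing
  ... | just f with f ∈ᵇ pvars (output l) in eqᵇ
  summedArrow-spec p l ()          | just f | true
  summedArrow-spec p l (here refl) | just f | false =
    arrVar-∈ (pvars p) eq , λ f∈O → case trans (sym (∈ᵇ-true f∈O)) eqᵇ of λ ()

  FactsStep : Maybe Var → Pat → Exp → List Factor → List Factor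
  FactsStep nothing  p e Γ = Fact p e ∷ Γ
  FactsStep (just f) p e Γ = ΣF (f ∷ []) (Fact p e ⊙ ⨀ (Γ[ Γ ] (f ∷ []))) ∷ Γ¬[ Γ ] (f ∷ [])

  Facts-lett : ∀ p e l → Facts (lett p e l) ≡ FactsStep (summedArrow p l) p e (Facts l)
  Facts-lett p e l with arrVar (pvars p)
  ... | nothing = refl
  ... | just f with f ∈ᵇ pvars (output l)
  ...   | true  = refl
  ...   | false = refl

  VarΓ-FactsStep⁻ : ∀ h p e Γ {v} → v ∈ VarΓ (FactsStep h p e Γ) →
    (v ∈ vars (Fact p e) ⊎ v ∈ VarΓ Γ) × v ∉ fromMaybe h
  VarΓ-FactsStep⁻ nothing  p e Γ m = ∈-++⁻ (vars (Fact p e)) m , λ ()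
  VarΓ-FactsStep⁻ (just f) p e Γ m with ∈-++⁻ (vars (Fact p e ⊙ ⨀ (Γ[ Γ ] (f ∷ []))) ∖ (f ∷ [])) m
  ... | inj₁ m∈ψ∖f =
    let m∈ψ , v∉f = ∈-∖⁻ (vars (Fact p e ⊙ ⨀ (Γ[ Γ ] (f ∷ [])))) (f ∷ []) m∈ψ∖f
    in Sum.map₂ (λ m∈Γf → VarΓ-filter⁻ (touches (f ∷ [])) Γ (subst (_ ∈_) (vars-⨀ (Γ[ Γ ] (f ∷ []))) m∈Γf))
                (∈-++⁻ (vars (Fact p e)) m∈ψ) , v∉f
  ... | inj₂ m∈Γ¬ =
    inj₂ (VarΓ-filter⁻ (not ∘ touches (f ∷ [])) Γ m∈Γ¬) ,
    λ { (here refl) → ∉-VarΓ-untouched Γ (f ∷ []) (here refl) m∈Γ¬ }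

  VarΓ-FactsStep⁺ : ∀ h p e Γ {v} → v ∈ vars (Fact p e) ⊎ v ∈ VarΓ Γ → v ∉ fromMaybe h →
    v ∈ VarΓ (FactsStep h p e Γ)
  VarΓ-FactsStep⁺ nothing  p e Γ m _ = [ ∈-++⁺ˡ , ∈-++⁺ʳ (vars (Fact p e)) ]′ m
  VarΓ-FactsStep⁺ (just f) p e Γ (inj₁ m∈Fact) v∉f = ∈-++⁺ˡ (∈-∖⁺ (f ∷ []) (∈-++⁺ˡ m∈Fact) v∉f)
  VarΓ-FactsStep⁺ (just f) p e Γ (inj₂ m∈Γ) v∉f with VarΓ-filter-split (touches (f ∷ [])) Γ m∈Γ
  ... | inj₁ m∈Γf = ∈-++⁺ˡ (∈-∖⁺ (f ∷ [])
    (∈-++⁺ʳ (vars (Fact p e)) (subst (_ ∈_) (sym (vars-⨀ (Γ[ Γ ] (f ∷ [])))) m∈Γf)) v∉f)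
  ... | inj₂ m∈Γ¬ = ∈-++⁺ʳ (vars (ΣF (f ∷ []) (Fact p e ⊙ ⨀ (Γ[ Γ ] (f ∷ []))))) m∈Γ¬

  FactsStep-local : ∀ h p e {Γ} → All Local Γ → All Local (FactsStep h p e Γ)
  FactsStep-local nothing  p e lΓ = Fact-local p e ∷ lΓ
  FactsStep-local (just f) p e lΓ =
    ΣF-local (f ∷ []) (⊙-local (Fact-local p e) (⨀-local (All.filter⁺ (T? ∘ touches (f ∷ [])) lΓ))) ∷
    All.filter⁺ (T? ∘ not ∘ touches (f ∷ [])) lΓ

  ⨀-FactsStep : ∀ h p e Γ → (∀ {v} → v ∈ fromMaybe h → v ∈ pvars p) → All Local Γ → ∀ ρ →
    fn (⨀ (FactsStep h p e Γ)) ρ ≈ sumOverL (fromMaybe h) (λ τ → fn (Fact p e) τ * fn (⨀ Γ) τ) ρ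
  ⨀-FactsStep nothing  p e Γ _   _  ρ = ≈-refl
  ⨀-FactsStep (just f) p e Γ f∈p lΓ ρ = begin
    fn (ΣF (f ∷ []) ψ) ρ * fn (⨀ Γ¬) ρ
      ≈⟨ *-cong (sumOver≈sumOverL ((f ∷ []) ∩ vars ψ) ([] ∷ [])
           (λ m → proj₁ (∈-∩⁻ (f ∷ []) (vars ψ) m)) (λ { (here refl) → ∈-∩⁺ (here refl) f∈ψ })
           (DependsOn⇒Extensional (⊙-local (Fact-local p e) (⨀-local lΓf))) ρ) ≈-refl ⟩
    sumW (ty f) (λ x → fn ψ (upd ρ f x)) * fn (⨀ Γ¬) ρ
      ≈⟨ sumL-*ʳ _ _ (enum (ty f)) ⟩
    sumW (ty f) (λ x → fn ψ (upd ρ f x) * fn (⨀ Γ¬) ρ)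
      ≈⟨ sumL-cong (enum (ty f)) (λ x → regroup (upd ρ f x) (upd-≢ ρ f x)) ⟩
    sumW (ty f) (λ x → fn (Fact p e) (upd ρ f x) * fn (⨀ Γ) (upd ρ f x)) ∎
    where
    Γf = Γ[ Γ ] (f ∷ [])
    Γ¬ = Γ¬[ Γ ] (f ∷ [])
    ψ = Fact p e ⊙ ⨀ Γf
    lΓf : All Local Γf
    lΓf = All.filter⁺ (T? ∘ touches (f ∷ [])) lΓ
    f∈ψ : f ∈ vars ψ
    f∈ψ = ∈-++⁺ˡ (∈-++⁺ʳ (FV e) (f∈p (here refl)))
    regroup : ∀ σ → (∀ {w} → w ≢ f → σ w ≡ ρ w) → fn ψ σ * fn (⨀ Γ¬) ρ ≈ fn (Fact p e) σ * fn (⨀ Γ) σ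
    regroup σ σ≐ρ = begin
      (fn (Fact p e) σ * fn (⨀ Γf) σ) * fn (⨀ Γ¬) ρ
        ≈⟨ *-cong ≈-refl (⨀-local (All.filter⁺ (T? ∘ not ∘ touches (f ∷ [])) lΓ) ρ σ λ m →
             sym (σ≐ρ λ { refl → ∉-VarΓ-untouched Γ (f ∷ []) (here refl) (subst (_ ∈_) (vars-⨀ Γ¬) m) })) ⟩
      (fn (Fact p e) σ * fn (⨀ Γf) σ) * fn (⨀ Γ¬) σ
        ≈⟨ *-assoc _ _ _ ⟩
      fn (Fact p e) σ * (fn (⨀ Γf) σ * fn (⨀ Γ¬) σ)
        ≈⟨ *-cong ≈-refl (⨀-filter-split (touches (f ∷ [])) Γ σ) ⟩
      fn (Fact p e) σ * fn (⨀ Γ) σ ∎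

  Facts-local : ∀ l → All Local (Facts l)
  Facts-local (out w)      = (λ _ _ _ → ≈-refl) ∷ []
  Facts-local (lett p e l) =
    subst (All Local) (sym (Facts-lett p e l)) (FactsStep-local (summedArrow p l) p e (Facts-local l))

  -- Let-terms

  record Barendregt (l : LetTerm) : Set where
    field
      bound-unique : Unique (boundVars l)
      bound#free   : Disjoint (boundVars l) (FV (toExp l))
  open Barendregt

  module _ {p e l} (bc : Barendregt (lett p e l)) where

    unique-pat : Unique (pvars p)
    unique-pat = proj₁ (Unique-++⁻ (pvars p) (bound-unique bc))

    pat#bound : Disjoint (pvars p) (boundVars l)
    pat#bound = proj₂ (proj₂ (Unique-++⁻ (pvars p) (bound-unique bc)))

    FV-def#bound : ∀ {v} → v ∈ FV e → v ∉ boundVars (lett p e l)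
    FV-def#bound v∈e v∈B = bound#free bc _ v∈B (∈-++⁺ˡ v∈e)

    Fact#bound : ∀ {v} → v ∈ boundVars l → v ∉ vars (Fact p e)
    Fact#bound v∈B v∈Fact =
      [ (λ v∈e → FV-def#bound v∈e (∈-++⁺ʳ (pvars p) v∈B)) , (λ v∈p → pat#bound _ v∈p v∈B) ]′ (∈-++⁻ (FV e) v∈Fact)

    Barendregt-tail : Barendregt l
    bound-unique Barendregt-tail = proj₁ (proj₂ (Unique-++⁻ (pvars p) (bound-unique bc)))
    bound#free Barendregt-tail v v∈B v∈F = case v ∈? pvars p of λ
      { (yes v∈p) → pat#bound v v∈p v∈B
      ; (no v∉p)  → bound#free bc v (∈-++⁺ʳ (pvars p) v∈B) (∈-++⁺ʳ (FV e) (∈-∖⁺ (pvars p) v∈F v∉p)) }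

  scope-lett : ∀ p e l {v} → v ∈ FV (toExp l) ⊎ v ∈ boundVars l →
    v ∈ FV (toExp (lett p e l)) ⊎ v ∈ boundVars (lett p e l)
  scope-lett p e l {v} (inj₁ v∈F) with v ∈? pvars p
  ... | yes v∈p = inj₂ (∈-++⁺ˡ v∈p)
  ... | no v∉p  = inj₁ (∈-++⁺ʳ (FV e) (∈-∖⁺ (pvars p) v∈F v∉p))
  scope-lett p e l (inj₂ v∈B) = inj₂ (∈-++⁺ʳ (pvars p) v∈B)

  Fact-scope : ∀ p e l {v} → v ∈ vars (Fact p e) → v ∈ FV (toExp (lett p e l)) ⊎ v ∈ boundVars (lett p e l)
  Fact-scope p e l v∈Fact = Sum.map ∈-++⁺ˡ ∈-++⁺ˡ (∈-++⁻ (FV e) v∈Fact)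

  FV-patExp : ∀ w → FV (patExp w) ≡ pvars w
  FV-patExp (pv v)   = refl
  FV-patExp (pp p q) = cong₂ _++_ (FV-patExp p) (FV-patExp q)

  output-scope : ∀ l {v} → v ∈ pvars (output l) → v ∈ FV (toExp l) ⊎ v ∈ boundVars l
  output-scope (out w)      v∈O = inj₁ (subst (_ ∈_) (sym (FV-patExp w)) v∈O)
  output-scope (lett p e l) v∈O = scope-lett p e l (output-scope l v∈O)

  VarΓ-Facts-scope : ∀ l {v} → v ∈ VarΓ (Facts l) → v ∈ FV (toExp l) ⊎ v ∈ boundVars l
  VarΓ-Facts-scope (out w) m = output-scope (out w) (subst (_ ∈_) (++-identityʳ (pvars w)) m)
  VarΓ-Facts-scope (lett p e l) m
    with VarΓ-FactsStep⁻ (summedArrow p l) p e (Facts l) (subst (λ Γ → _ ∈ VarΓ Γ) (Facts-lett p e l) m)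
  ... | inj₁ v∈Fact , _ = Fact-scope p e l v∈Fact
  ... | inj₂ v∈Γ    , _ = scope-lett p e l (VarΓ-Facts-scope l v∈Γ)

  ∏Fact : LetTerm → Env → K
  ∏Fact (out w)      τ = 1#
  ∏Fact (lett p e l) τ = fn (Fact p e) τ * ∏Fact l τ

  ∏Fact-local : ∀ l → DependsOn (λ v → v ∈ FV (toExp l) ⊎ v ∈ boundVars l) (∏Fact l)
  ∏Fact-local (out w)      ρ ρ′ eq = ≈-refl
  ∏Fact-local (lett p e l) ρ ρ′ eq =
    *-cong (Fact-local p e ρ ρ′ λ m → eq (Fact-scope p e l m)) (∏Fact-local l ρ ρ′ λ m → eq (scope-lett p e l m))

  summedArrows : LetTerm → List Var
  summedArrows (out w)      = []
  summedArrows (lett p e l) = fromMaybe (summedArrow p l) ++ summedArrows l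

  summedArrows-scope : ∀ l {v} → v ∈ summedArrows l → v ∈ boundVars l × v ∉ pvars (output l)
  summedArrows-scope (out w) ()
  summedArrows-scope (lett p e l) m with ∈-++⁻ (fromMaybe (summedArrow p l)) m
  ... | inj₁ v∈h  = Product.map₁ ∈-++⁺ˡ (summedArrow-spec p l v∈h)
  ... | inj₂ v∈Ar = Product.map₁ (∈-++⁺ʳ (pvars p)) (summedArrows-scope l v∈Ar)

  summedArrows-unique : ∀ l → Barendregt l → Unique (summedArrows l)
  summedArrows-unique (out w)      bc = []
  summedArrows-unique (lett p e l) bc = Unique.++⁺ (fromMaybe-unique (summedArrow p l))
    (summedArrows-unique l (Barendregt-tail bc))
    λ (v∈h , v∈Ar) → pat#bound bc _ (proj₁ (summedArrow-spec p l v∈h)) (proj₁ (summedArrows-scope l v∈Ar))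

  summedArrows#VarΓ : ∀ l → Barendregt l → ∀ {v} → v ∈ summedArrows l → v ∉ VarΓ (Facts l)
  summedArrows#VarΓ (out w) bc ()
  summedArrows#VarΓ (lett p e l) bc v∈Ar m
    with VarΓ-FactsStep⁻ (summedArrow p l) p e (Facts l) (subst (λ Γ → _ ∈ VarΓ Γ) (Facts-lett p e l) m)
       | ∈-++⁻ (fromMaybe (summedArrow p l)) v∈Ar
  ... | _                , v∉h | inj₁ v∈h   = v∉h v∈h
  ... | inj₁ v∈Fact , _        | inj₂ v∈Arl = Fact#bound bc (proj₁ (summedArrows-scope l v∈Arl)) v∈Fact
  ... | inj₂ v∈Γ    , _        | inj₂ v∈Arl = summedArrows#VarΓ l (Barendregt-tail bc) v∈Arl v∈Γ

  bound∈VarΓ : ∀ l {v} → v ∈ boundVars l → v ∉ summedArrows l → v ∈ VarΓ (Facts l)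
  bound∈VarΓ (out w) ()
  bound∈VarΓ (lett p e l) v∈B v∉Ar = subst (λ Γ → _ ∈ VarΓ Γ) (sym (Facts-lett p e l))
    (VarΓ-FactsStep⁺ (summedArrow p l) p e (Facts l) source (λ v∈h → v∉Ar (∈-++⁺ˡ v∈h)))
    where
    source = [ (λ v∈p → inj₁ (∈-++⁺ʳ (FV e) v∈p))
             , (λ v∈Bl → inj₂ (bound∈VarΓ l v∈Bl λ v∈Arl → v∉Ar (∈-++⁺ʳ _ v∈Arl))) ]′ (∈-++⁻ (pvars p) v∈B)

  ⨀Facts≈sum∏Fact : ∀ l → Barendregt l → ∀ ρ → fn (⨀ (Facts l)) ρ ≈ sumOverL (summedArrows l) (∏Fact l) ρ
  ⨀Facts≈sum∏Fact (out w)      bc ρ = *-identityˡ 1#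
  ⨀Facts≈sum∏Fact (lett p e l) bc ρ = begin
    fn (⨀ (Facts (lett p e l))) ρ
      ≡⟨ cong (λ Γ → fn (⨀ Γ) ρ) (Facts-lett p e l) ⟩
    fn (⨀ (FactsStep (summedArrow p l) p e (Facts l))) ρ
      ≈⟨ ⨀-FactsStep (summedArrow p l) p e (Facts l) (λ m → proj₁ (summedArrow-spec p l m)) (Facts-local l) ρ ⟩
    sumOverL hs (λ τ → fn (Fact p e) τ * fn (⨀ (Facts l)) τ) ρ
      ≈⟨ sumOverL-cong hs ρ (λ τ _ → ≈-trans (*-cong ≈-refl (⨀Facts≈sum∏Fact l (Barendregt-tail bc) τ))
           (sumOverL-*ˡ-local (summedArrows l) (∏Fact l) (Fact-local p e)
              (λ m → Fact#bound bc (proj₁ (summedArrows-scope l m))) τ)) ⟩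
    sumOverL hs (sumOverL (summedArrows l) (∏Fact (lett p e l))) ρ
      ≈⟨ ≈-sym (sumOverL-++ hs (summedArrows l) _ ρ) ⟩
    sumOverL (summedArrows (lett p e l)) (∏Fact (lett p e l)) ρ ∎
    where hs = fromMaybe (summedArrow p l)

  infer-patExp : ∀ w → infer (patExp w) ≡ ptype w
  infer-patExp (pv v)   = refl
  infer-patExp (pp p q) = cong₂ _⊗_ (infer-patExp p) (infer-patExp q)

  ⟦patExp⟧≈δ-matches : ∀ w τ b →
    ⟦ patExp w ⟧ τ (coe (ptype w) (infer (patExp w)) (tuple w b)) ≈ δ (matches w τ b)
  ⟦patExp⟧≈δ-matches (pv v)   τ b = reflexive (cong (λ t → δ (eqW (ty v) (τ v) t)) (coe-refl (ty v) (b v)))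
  ⟦patExp⟧≈δ-matches (pp p q) τ b = begin
    ⟦ patExp (pp p q) ⟧ τ (coe (ptype (pp p q)) (infer (patExp (pp p q))) (tuple p b , tuple q b))
      ≡⟨ cong (⟦ patExp (pp p q) ⟧ τ)
           (coe-⊗ (tuple p b) (tuple q b) (sym (infer-patExp p)) (sym (infer-patExp q))) ⟩
    ⟦ patExp p ⟧ τ (coe (ptype p) (infer (patExp p)) (tuple p b)) *
    ⟦ patExp q ⟧ τ (coe (ptype q) (infer (patExp q)) (tuple q b))
      ≈⟨ *-cong (⟦patExp⟧≈δ-matches p τ b) (⟦patExp⟧≈δ-matches q τ b) ⟩
    δ (matches p τ b) * δ (matches q τ b)
      ≈⟨ ≈-sym (δ-∧ (matches p τ b) (matches q τ b)) ⟩
    δ (matches (pp p q) τ b) ∎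

  ⟦⟧L≈sum∏Fact : ∀ l → Barendregt l → ∀ a b →
    ⟦ l ⟧L a b ≈ sumOverL (boundVars l) (λ τ → ∏Fact l τ * δ (matches (output l) τ b)) a
  ⟦⟧L≈sum∏Fact (out w)      bc a b = ≈-trans (⟦patExp⟧≈δ-matches w a b) (≈-sym (*-identityˡ _))
  ⟦⟧L≈sum∏Fact (lett p e l) bc a b = begin
    sumOver (pvars p) (λ σ → G σ * ⟦ l ⟧L σ b) a
      ≈⟨ sumOver≈sumOverL (pvars p) (unique-pat bc) id id ext a ⟩
    sumOverL (pvars p) (λ σ → G σ * ⟦ l ⟧L σ b) a
      ≈⟨ sumOverL-cong (pvars p) a (λ σ σ≐a →
           *-cong (G≈Fact σ σ≐a) (⟦⟧L≈sum∏Fact l (Barendregt-tail bc) σ b)) ⟩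
    sumOverL (pvars p) (λ σ → fn (Fact p e) σ * sumOverL (boundVars l) H σ) a
      ≈⟨ sumOverL-cong (pvars p) a (λ σ _ → sumOverL-*ˡ-local (boundVars l) H (Fact-local p e) (Fact#bound bc) σ) ⟩
    sumOverL (pvars p) (sumOverL (boundVars l) (λ τ → fn (Fact p e) τ * H τ)) a
      ≈⟨ ≈-sym (sumOverL-++ (pvars p) (boundVars l) _ a) ⟩
    sumOverL (boundVars (lett p e l)) (λ τ → fn (Fact p e) τ * H τ) a
      ≈⟨ sumOverL-cong (boundVars (lett p e l)) a (λ τ _ → ≈-sym (*-assoc _ _ _)) ⟩
    sumOverL (boundVars (lett p e l)) (λ τ → ∏Fact (lett p e l) τ * δ (matches (output l) τ b)) a ∎
    where
    G : Env → K
    G σ = ⟦ e ⟧ a (coe (ptype p) (infer e) (tuple p σ))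
    H : Env → K
    H τ = ∏Fact l τ * δ (matches (output l) τ b)
    G≈Fact : ∀ σ → EqOn (_∉ pvars p) σ a → G σ ≈ fn (Fact p e) σ
    G≈Fact σ σ≐a = ⟦⟧-local e _ a σ λ v∈e → sym (σ≐a λ v∈p → FV-def#bound bc v∈e (∈-++⁺ˡ v∈p))
    ext : Extensional (λ σ → G σ * ⟦ l ⟧L σ b)
    ext σ σ′ σ≐ = *-cong
      (reflexive (cong (λ t → ⟦ e ⟧ a (coe (ptype p) (infer e) t)) (tuple-cong p λ {v} _ → σ≐ v)))
      (DependsOn⇒Extensional (⟦⟧-local (toExp l) _) σ σ′ σ≐)

  marginal : LetTerm → Factor
  marginal l = ΣF (VarΓ (Facts l) ∖ (FV (toExp l) ++ pvars (output l))) (⨀ (Facts l))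

  marginal≈sum∏Fact : ∀ l → Barendregt l → ∀ ρ →
    fn (marginal l) ρ ≈ sumOverL (boundVars l ∖ pvars (output l)) (∏Fact l) ρ
  marginal≈sum∏Fact l bc ρ = begin
    sumOverL D (fn (⨀ Γ)) ρ
      ≈⟨ sumOverL-cong D ρ (λ σ _ → ⨀Facts≈sum∏Fact l bc σ) ⟩
    sumOverL D (sumOverL Ar (∏Fact l)) ρ
      ≈⟨ ≈-sym (sumOverL-++ D Ar (∏Fact l) ρ) ⟩
    sumOverL (D ++ Ar) (∏Fact l) ρ
      ≈⟨ sumOverL-↭ D++Ar↭B∖O (DependsOn⇒Extensional (∏Fact-local l)) ρ ⟩
    sumOverL (B ∖ O) (∏Fact l) ρ ∎
    where
    Γ = Facts l
    F = FV (toExp l)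
    O = pvars (output l)
    B = boundVars l
    Ar = summedArrows l
    S = VarΓ Γ ∖ (F ++ O)
    D = deduplicate _≟V_ (S ∩ vars (⨀ Γ))
    D⁻ : ∀ {v} → v ∈ D → v ∈ VarΓ Γ × v ∉ F ++ O
    D⁻ m = ∈-∖⁻ (VarΓ Γ) (F ++ O) (proj₁ (∈-∩⁻ S (vars (⨀ Γ)) (∈-deduplicate⁻ _≟V_ (S ∩ vars (⨀ Γ)) m)))
    D⁺ : ∀ {v} → v ∈ VarΓ Γ → v ∉ F ++ O → v ∈ D
    D⁺ v∈Γ v∉FO = ∈-deduplicate⁺ _≟V_ (∈-∩⁺ (∈-∖⁺ (F ++ O) v∈Γ v∉FO) (subst (_ ∈_) (sym (vars-⨀ Γ)) v∈Γ))
    to : ∀ {v} → v ∈ D ++ Ar → v ∈ B ∖ O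
    to m with ∈-++⁻ D m
    ... | inj₂ v∈Ar = let v∈B , v∉O = summedArrows-scope l v∈Ar in ∈-∖⁺ O v∈B v∉O
    ... | inj₁ v∈D with D⁻ v∈D
    ...   | v∈Γ , v∉FO = ∈-∖⁺ O
            ([ (λ v∈F → ⊥-elim (v∉FO (∈-++⁺ˡ v∈F))) , id ]′ (VarΓ-Facts-scope l v∈Γ)) (λ v∈O → v∉FO (∈-++⁺ʳ F v∈O))
    from : ∀ {v} → v ∈ B ∖ O → v ∈ D ++ Ar
    from {v} m with ∈-∖⁻ B O m | v ∈? Ar
    ... | _ , _ | yes v∈Ar = ∈-++⁺ʳ D v∈Ar
    ... | v∈B , v∉O | no v∉Ar = ∈-++⁺ˡ (D⁺ (bound∈VarΓ l v∈B v∉Ar)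
            λ v∈FO → [ bound#free bc v v∈B , v∉O ]′ (∈-++⁻ F v∈FO))
    D++Ar↭B∖O : D ++ Ar ↭ B ∖ O
    D++Ar↭B∖O = unique-sameElements⇒↭
      (Unique.++⁺ (deduplicate-! _) (summedArrows-unique l bc)
        λ (v∈D , v∈Ar) → summedArrows#VarΓ l bc v∈Ar (proj₁ (D⁻ v∈D)))
      (Unique.filter⁺ _ (bound-unique bc)) to from

  merge-∈ : ∀ V a b {v} → v ∈ V → merge V a b v ≡ a v
  merge-∈ V a b v∈ rewrite ∈ᵇ-true v∈ = refl

  merge-∉ : ∀ V a b {v} → v ∉ V → merge V a b v ≡ b v
  merge-∉ V a b v∉ rewrite ∈ᵇ-false v∉ = refl

  ⟦⟧L≈δ*marginal : ∀ l → Barendregt l → ∀ a b → let m = merge (FV (toExp l)) a b in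
    ⟦ l ⟧L a b ≈ δ (matches (output l) m b) * fn (marginal l) m
  ⟦⟧L≈δ*marginal l bc a b = begin
    ⟦ l ⟧L a b
      ≈⟨ ⟦⟧L≈sum∏Fact l bc a b ⟩
    sumOverL B g a
      ≈⟨ sumOverL-local B g-local a m a≐m ⟩
    sumOverL B g m
      ≈⟨ sumOverL-matches w b B (bound-unique bc) (DependsOn⇒Extensional (∏Fact-local l)) m m≐b ⟩
    δ (matches w m b) * sumOverL (B ∖ pvars w) (∏Fact l) m
      ≈⟨ *-cong ≈-refl (≈-sym (marginal≈sum∏Fact l bc m)) ⟩
    δ (matches w m b) * fn (marginal l) m ∎
    where
    w = output l
    F = FV (toExp l)
    B = boundVars l
    m = merge F a b
    g : Env → K
    g τ = ∏Fact l τ * δ (matches w τ b)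
    g-local : DependsOn (λ v → v ∈ F ⊎ v ∈ B) g
    g-local ρ ρ′ eq = *-cong (∏Fact-local l ρ ρ′ eq)
      (reflexive (cong δ (matches-cong w b λ v∈O → eq (output-scope l v∈O))))
    a≐m : EqOn (λ v → (v ∈ F ⊎ v ∈ B) × v ∉ B) a m
    a≐m (inj₁ v∈F , _)   = sym (merge-∈ F a b v∈F)
    a≐m (inj₂ v∈B , v∉B) = ⊥-elim (v∉B v∈B)
    m≐b : EqOn (_∈ B ∩ pvars w) m b
    m≐b v∈ = merge-∉ F a b (bound#free bc _ (proj₁ (∈-∩⁻ B (pvars w) v∈)))

  Agree⇒matches : ∀ l {a b} → Agree l a b → matches (output l) (merge (FV (toExp l)) a b) b ≡ true
  Agree⇒matches l {a} {b} ag = matches-complete (output l) λ {v} v∈O → case v ∈? FV (toExp l) of λ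
    { (yes v∈F) → trans (merge-∈ (FV (toExp l)) a b v∈F) (ag v v∈F v∈O)
    ; (no v∉F)  → merge-∉ (FV (toExp l)) a b v∉F }

  matches⇒Agree : ∀ l {a b} → matches (output l) (merge (FV (toExp l)) a b) b ≡ true → Agree l a b
  matches⇒Agree l {a} {b} eq v v∈F v∈O =
    trans (sym (merge-∈ (FV (toExp l)) a b v∈F)) (matches-sound (output l) eq v∈O)

  ⟦⟧L-agree : ∀ l → Barendregt l → ∀ {a b} → Agree l a b →
    ⟦ l ⟧L a b ≈ fn (marginal l) (merge (FV (toExp l)) a b)
  ⟦⟧L-agree l bc {a} {b} ag = begin
    ⟦ l ⟧L a b                                     ≈⟨ ⟦⟧L≈δ*marginal l bc a b ⟩
    δ (matches (output l) m b) * fn (marginal l) m ≡⟨ cong (λ t → δ t * fn (marginal l) m) (Agree⇒matches l ag) ⟩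
    1# * fn (marginal l) m                         ≈⟨ *-identityˡ _ ⟩
    fn (marginal l) m                              ∎
    where m = merge (FV (toExp l)) a b

  ⟦⟧L-disagree : ∀ l → Barendregt l → ∀ {a b} → ¬ Agree l a b → ⟦ l ⟧L a b ≈ 0#
  ⟦⟧L-disagree l bc {a} {b} ¬ag = begin
    ⟦ l ⟧L a b                                     ≈⟨ ⟦⟧L≈δ*marginal l bc a b ⟩
    δ (matches (output l) m b) * fn (marginal l) m ≡⟨ cong (λ t → δ t * fn (marginal l) m) matches≡false ⟩
    0# * fn (marginal l) m                         ≈⟨ zeroˡ _ ⟩
    0#                                             ∎
    where
    m = merge (FV (toExp l)) a b
    matches≡false : matches (output l) m b ≡ false
    matches≡false = ¬-not (¬ag ∘ matches⇒Agree l)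

  -- With FV ℓ = [], the list [] ++ O is O and merge [] a b computes to b.
  ⟦⟧L-closed : ∀ l → Barendregt l → FV (toExp l) ≡ [] → ∀ a b →
    ⟦ l ⟧L a b ≈ fn (ΣF (VarΓ (Facts l) ∖ pvars (output l)) (⨀ (Facts l))) b
  ⟦⟧L-closed l bc F≡[] a b =
    subst (λ V → ⟦ l ⟧L a b ≈ fn (ΣF (VarΓ (Facts l) ∖ (V ++ pvars (output l))) (⨀ (Facts l))) (merge V a b))
      F≡[] (⟦⟧L-agree l bc λ v v∈F _ → ⊥-elim (¬Any[] (subst (v ∈_) F≡[] v∈F)))

proposition3 : {c r : Level} (R : CommutativeSemiring c r) →
    let open Sem R
    in (l : LetTerm) (U : Ty) → Typed (toExp l) U →
       Unique (boundVars l) → Disjoint (boundVars l) (FV (toExp l)) →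
       ((a b : Env) →
          (Agree l a b →
             ⟦ l ⟧L a b ≈ fn (ΣF (VarΓ (Facts l) ∖ (FV (toExp l) ++ pvars (output l))) (⨀ (Facts l)))
                           (merge (FV (toExp l)) a b))
          × (¬ Agree l a b → ⟦ l ⟧L a b ≈ 0#))
       × (FV (toExp l) ≡ [] → (a b : Env) →
            ⟦ l ⟧L a b ≈ fn (ΣF (VarΓ (Facts l) ∖ pvars (output l)) (⨀ (Facts l))) b)
proposition3 R l _ _ uniq disj = (λ a b → ⟦⟧L-agree R l bc , ⟦⟧L-disagree R l bc) , ⟦⟧L-closed R l bc
  where
  bc : Barendregt R l
  bc = record { bound-unique = uniq ; bound#free = disj }
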